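{- There is an absolute constant $c>0$ such that the following holds. Let $G = C(m_1,\dots,m_n)$ be a caterpillar and let $T_1, T_2$ be search trees on $G$ without free leg nodes. Then $T_1$ can be transformed into $T_2$ using at most $c\cdot n$ rotations.
   Context: For $n \in \mathbb{N}_+$ and $m_1,\dots,m_n \in \mathbb{N}_0$, the caterpillar $C(m_1,\dots,m_n)$ is the tree with spine vertices $s_1,\dots,s_n$ forming a path in this order, and for each $i\in[n]$, $j\in[m_i]$ a leg vertex $\ell_{i,j}$ adjacent only to $s_i$. A search tree on a connected graph $G$ (STG) is a rooted tree $T$ with $V(T)=V(G)$ such that, if $r$ is the root with children $c_1,\dots,c_k$, then $G\setminus r$ has exactly $k$ connected components $C_1,\dots,C_k$ with $V(T_{c_i}) = V(C_i)$ and $T_{c_i}$ a search tree on $C_i$ for each $i$ ($T_x$ denotes the subtree of $x$ and its descendants). A rotation of an edge $(p,c)$ of $T$, $c$ a child of $p$, produces the STG in which $c$ takes the place of $p$ (child of the former parent of $p$, or root), $p$ becomes a child of $c$, each child $x$ of $c$ such that $V(T_x)$ contains a vertex adjacent in $G$ to $p$ becomes a child of $p$, and all other parent–child relations are unchanged. In a search tree on a caterpillar, nodes corresponding to leg vertices are leg nodes; a leg node is bound if it has no children in the search tree and free otherwise. -}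

module Defs where

open import Data.Nat using (ℕ; zero; suc)
open import Data.Fin using (Fin; toℕ)
open import Data.Maybe using (Maybe; just; nothing)
open import Data.Product using (Σ; _×_)
open import Relation.Binary.PropositionalEquality using (_≡_; _≢_)
open import Relation.Nullary using (¬_)

record Graph : Set₁ where
  field
    V   : Set
    Adj : V → V → Set

module _ (G : Graph) where
  open Graph G

  Parent : Set
  Parent = V → Maybe V

  -- Anc par a y : a is an ancestor of y (reflexively), i.e. y ∈ V(T_a).
  data Anc (par : Parent) (a : V) : V → Set where
    here  : Anc par a a
    there : ∀ {x y} → par y ≡ just x → Anc par a x → Anc par a y

  data PathIn (S : V → Set) : V → V → Set where
    stop : ∀ {x} → S x → PathIn S x x
    go   : ∀ {x z y} → S x → Adj x z → PathIn S z y → PathIn S x y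

  -- S is (the vertex set of) a connected component of the induced subgraph G[U].
  IsComponent : (U S : V → Set) → Set
  IsComponent U S =
    (∀ x → S x → U x)
    × Σ V S
    × (∀ x y → S x → S y → PathIn S x y)
    × (∀ x y → S x → U y → ¬ S y → ¬ Adj x y)

  IsRootedTree : Parent → V → Set
  IsRootedTree par r = (par r ≡ nothing) × (∀ v → Anc par r v)

  -- Search tree on G (recursive definition unfolded at every node):
  -- a rooted tree on V(G) such that for every node v, the vertex sets of the
  -- subtrees of the children of v are exactly the connected components of
  -- G[V(T_v) ∖ {v}] (children ↔ components is a bijection since the child
  -- subtrees partition V(T_v) ∖ {v}).
  IsSearchTree : Parent → Set
  IsSearchTree par =
    Σ V λ r → IsRootedTree par r
      × (∀ v c → par c ≡ just v →
           IsComponent (λ x → Anc par v x × (x ≢ v)) (Anc par c))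

  SubtreeAdj : Parent → V → V → Set
  SubtreeAdj par x p = Σ V λ y → Anc par x y × Adj y p

  RotationAt : Parent → Parent → V → V → Set
  RotationAt par par' p c =
    (par c ≡ just p)
    × (par' c ≡ par p)
    × (par' p ≡ just c)
    × (∀ x → x ≢ c → x ≢ p →
         (par x ≡ just c →
            (SubtreeAdj par x p → par' x ≡ just p)
            × (¬ SubtreeAdj par x p → par' x ≡ par x))
         × (par x ≢ just c → par' x ≡ par x))

  Rotation : Parent → Parent → Set
  Rotation par par' = Σ V λ p → Σ V λ c → RotationAt par par' p c

  data Steps : ℕ → Parent → Parent → Set where
    done : ∀ {t t'} → (∀ x → t x ≡ t' x) → Steps zero t t'
    step : ∀ {k t t' t''} → IsSearchTree t' → Rotation t t' → Steps k t' t'' →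
           Steps (suc k) t t''

data CatV (n : ℕ) (m : Fin n → ℕ) : Set where
  spine : Fin n → CatV n m
  leg   : (i : Fin n) → Fin (m i) → CatV n m

data CatAdj {n : ℕ} {m : Fin n → ℕ} : CatV n m → CatV n m → Set where
  spine-next : ∀ i j → suc (toℕ i) ≡ toℕ j → CatAdj (spine i) (spine j)
  spine-prev : ∀ i j → toℕ i ≡ suc (toℕ j) → CatAdj (spine i) (spine j)
  spine-leg  : ∀ i j → CatAdj (spine i) (leg i j)
  leg-spine  : ∀ i j → CatAdj (leg i j) (spine i)

Caterpillar : (n : ℕ) → (Fin n → ℕ) → Graph
Caterpillar n m = record { V = CatV n m ; Adj = CatAdj }

NoFreeLeg : (n : ℕ) (m : Fin n → ℕ) → Parent (Caterpillar n m) → Set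
NoFreeLeg n m par = ∀ i j x → par x ≢ just (leg i j)

module Submission where

-- A search tree without free leg nodes hangs every leg below its own spine
-- vertex, so it is determined by the search tree it induces on the spine
-- path, i.e. by a binary search tree on the spine indices 0 … n-1; conversely
-- every such binary search tree, with the legs hung below, is a search tree
-- on the caterpillar. Ordinary binary-search-tree rotations are rotations of
-- these search trees (a leg is never moved: its subtree is a singleton
-- adjacent only to its own spine vertex). A right rotation at the rightmost
-- path of a binary search tree lowers the number of nodes off that path by
-- one, so at most n rotations turn any such tree into the right comb 0 → 1 →
-- ⋯ → n-1. Going T₁ → comb → T₂ therefore takes at most 2n rotations.

open import Defs
open import Data.Nat using (ℕ; zero; suc; _+_; _*_; _∸_; _≤_; _<_; _≤?_; _<?_; z≤n; s≤s)
open import Data.Nat.Properties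
open import Data.Fin using (Fin; toℕ; fromℕ<)
open import Data.Fin.Properties using (toℕ-injective; toℕ-fromℕ<; toℕ<n)
import Data.Fin.Properties as Fin
open import Data.Maybe using (Maybe; just; nothing)
import Data.Maybe as Maybe
open import Data.Maybe.Properties using (just-injective)
open import Data.Product using (Σ; _×_; _,_; proj₁; proj₂)
open import Data.Sum using (_⊎_; inj₁; inj₂)
open import Data.Empty using (⊥; ⊥-elim)
open import Data.Unit using (⊤; tt)
open import Relation.Nullary using (¬_; Dec; yes; no; _×-dec_)
open import Relation.Binary.PropositionalEquality
open import Relation.Binary.Definitions using (Tri; tri<; tri≈; tri>; DecidableEquality)

module _ {G : Graph} where
  open Graph G

  Anc-trans : ∀ {par a x y} → Anc G par a x → Anc G par x y → Anc G par a y
  Anc-trans d here = d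
  Anc-trans d (there e d') = there e (Anc-trans d d')

  Anc-resp : ∀ {A B} → A ≗ B → ∀ {a y} → Anc G A a y → Anc G B a y
  Anc-resp eq here = here
  Anc-resp eq (there {y = y} e d) = there (trans (sym (eq y)) e) (Anc-resp eq d)

  Anc-to-root : ∀ {par a y} → Anc G par a y → par y ≡ nothing → a ≡ y
  Anc-to-root here _ = refl
  Anc-to-root (there e _) e' with trans (sym e') e
  ... | ()

  SubtreeAdj-resp : ∀ {A B} → A ≗ B → ∀ {x p} → SubtreeAdj G A x p → SubtreeAdj G B x p
  SubtreeAdj-resp eq (y , d , a) = y , Anc-resp eq d , a

  Rotation-respˡ : ∀ {A B B'} → A ≗ B → Rotation G B B' → Rotation G A B'
  Rotation-respˡ {A} {B} {B'} eq (p , c , e1 , e2 , e3 , f) =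
    p , c , trans (eq c) e1 , trans e2 (sym (eq p)) , e3 , g
    where
    g : ∀ x → x ≢ c → x ≢ p →
         (A x ≡ just c → (SubtreeAdj G A x p → B' x ≡ just p) × (¬ SubtreeAdj G A x p → B' x ≡ A x))
         × (A x ≢ just c → B' x ≡ A x)
    g x x≢c x≢p with f x x≢c x≢p
    ... | ifChild , otherwise =
      (λ ac → let (moved , kept) = ifChild (trans (sym (eq x)) ac)
              in (λ sa → moved (SubtreeAdj-resp eq sa))
               , (λ nsa → trans (kept (λ sb → nsa (SubtreeAdj-resp (λ z → sym (eq z)) sb))) (sym (eq x))))
      , λ nac → trans (otherwise (λ bc → nac (trans (eq x) bc))) (sym (eq x))

  Steps-respˡ : ∀ {k A B C} → A ≗ B → Steps G k B C → Steps G k A C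
  Steps-respˡ eq (done e) = done (λ x → trans (eq x) (e x))
  Steps-respˡ eq (step st r rest) = step st (Rotation-respˡ eq r) rest

  PathIn-head : ∀ {S x y} → PathIn G S x y → S x
  PathIn-head (stop s) = s
  PathIn-head (go s _ _) = s

  PathIn-snoc : ∀ {S x z y} → PathIn G S x z → S y → Adj z y → PathIn G S x y
  PathIn-snoc (stop s) sy a = go s a (stop sy)
  PathIn-snoc (go s a p) sy a' = go s a (PathIn-snoc p sy a')

  PathIn-++ : ∀ {S x z y} → PathIn G S x z → PathIn G S z y → PathIn G S x y
  PathIn-++ (stop _) q = q
  PathIn-++ (go s a p) q = go s a (PathIn-++ p q)

  module _ (_≟_ : DecidableEquality V) {par : Parent G} where

    child-towards : ∀ {a y} → Anc G par a y → y ≢ a → Σ V λ c → (par c ≡ just a) × Anc G par c y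
    child-towards here ne = ⊥-elim (ne refl)
    child-towards {a} {y} (there {x} e d) ne with x ≟ a
    ... | yes refl = y , e , here
    ... | no nx with child-towards d nx
    ...   | c , pc , dc = c , pc , there e dc

    Anc? : ∀ {r} → IsRootedTree G par r → ∀ a y → Dec (Anc G par a y)
    Anc? {r} (root-parent , root-Anc) a y = from-root (root-Anc y)
      where
      from-root : ∀ {y} → Anc G par r y → Dec (Anc G par a y)
      from-root {y} d with a ≟ y
      ... | yes refl = yes here
      from-root here | no ne = no (λ z → ne (Anc-to-root z root-parent))
      from-root (there {x} e d') | no ne with from-root d'
      ... | yes z = yes (there e z)
      ... | no nz = no λ { here → ne refl
                         ; (there e' z) → nz (subst (Anc G par a) (just-injective (trans (sym e') e)) z) }


module CaterpillarRotations (n : ℕ) (m : Fin n → ℕ) where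
  G : Graph
  G = Caterpillar n m

  V : Set
  V = CatV n m

  _≟V_ : DecidableEquality V
  spine i ≟V spine j with i Fin.≟ j
  ... | yes refl = yes refl
  ... | no ne = no λ { refl → ne refl }
  spine _ ≟V leg _ _ = no λ ()
  leg _ _ ≟V spine _ = no λ ()
  leg i a ≟V leg j b with i Fin.≟ j
  ... | no ne = no λ { refl → ne refl }
  ... | yes refl with a Fin.≟ b
  ... | yes refl = yes refl
  ... | no ne = no λ { refl → ne refl }

  index : V → ℕ
  index (spine i) = toℕ i
  index (leg i _) = toℕ i

  index<n : ∀ x → index x < n
  index<n (spine i) = toℕ<n i
  index<n (leg i _) = toℕ<n i

  InRange : ℕ → ℕ → ℕ → Set
  InRange lo hi x = (lo ≤ x) × (x < hi)

  inRange? : ∀ lo hi x → Dec (InRange lo hi x)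
  inRange? lo hi x = lo ≤? x ×-dec x <? hi

  CatAdj-sym : ∀ {x y : V} → CatAdj x y → CatAdj y x
  CatAdj-sym (spine-next i j e) = spine-prev j i (sym e)
  CatAdj-sym (spine-prev i j e) = spine-next j i (sym e)
  CatAdj-sym (spine-leg i j) = leg-spine i j
  CatAdj-sym (leg-spine i j) = spine-leg i j

  AdjIndex : V → V → Set
  AdjIndex x y = (index x ≡ index y)
               ⊎ (Σ (Fin n) λ j → (y ≡ spine j) × (suc (index x) ≡ toℕ j))
               ⊎ (Σ (Fin n) λ j → (y ≡ spine j) × (index x ≡ suc (toℕ j)))

  adjIndex : ∀ {x y : V} → CatAdj x y → AdjIndex x y
  adjIndex (spine-next i j e) = inj₂ (inj₁ (j , refl , e))
  adjIndex (spine-prev i j e) = inj₂ (inj₂ (j , refl , e))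
  adjIndex (spine-leg i j) = inj₁ refl
  adjIndex (leg-spine i j) = inj₁ refl

  PathIn-reverse : ∀ {S x y} → PathIn G S x y → PathIn G S y x
  PathIn-reverse (stop s) = stop s
  PathIn-reverse (go s a p) = PathIn-snoc (PathIn-reverse p) s (CatAdj-sym a)

  interval-closed : ∀ (S : V → Set) {a b} (i₀ : Fin n) → toℕ i₀ ≡ a → S (spine i₀) →
    (∀ {x y} → S x → InRange a b (index y) → CatAdj x y → S y) →
    ∀ y → InRange a b (index y) → S y
  interval-closed S {a} {b} i₀ e₀ s₀ closed = all
    where
    spines : ∀ d i → toℕ i ≡ d + a → InRange a b (toℕ i) → S (spine i)
    spines zero i e _ with toℕ-injective (trans e (sym e₀))
    ... | refl = s₀
    spines (suc d) i e r = closed (spines d i' e' r') r (spine-next i' i (trans (cong suc e') (sym e)))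
      where
      d+a<i : d + a < toℕ i
      d+a<i = ≤-reflexive (sym e)
      i' : Fin n
      i' = fromℕ< (<-trans d+a<i (toℕ<n i))
      e' : toℕ i' ≡ d + a
      e' = toℕ-fromℕ< _
      r' : InRange a b (toℕ i')
      r' = subst (InRange a b) (sym e') (m≤n+m a d , <-trans d+a<i (proj₂ r))
    all : ∀ y → InRange a b (index y) → S y
    all (spine i) r = spines (toℕ i ∸ a) i (sym (m∸n+n≡m (proj₁ r))) r
    all (leg i c) r = closed (all (spine i) r) r (spine-leg i c)

  interval-path : ∀ (S : V → Set) {a b} → (∀ y → InRange a b (index y) → S y) →
    ∀ x y → InRange a b (index x) → InRange a b (index y) → PathIn G S x y
  interval-path S {a} {b} inS x y rx ry = PathIn-++ (PathIn-reverse (from-a x rx)) (from-a y ry)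
    where
    a<n : a < n
    a<n = ≤-<-trans (proj₁ rx) (index<n x)
    from-a : ∀ z → InRange a b (index z) → PathIn G S (spine (fromℕ< a<n)) z
    from-a = interval-closed (PathIn G S (spine (fromℕ< a<n))) (fromℕ< a<n) (toℕ-fromℕ< a<n)
               (stop (inS _ (subst (InRange a b) (sym (toℕ-fromℕ< a<n)) (≤-refl , ≤-<-trans (proj₁ rx) (proj₂ rx)))))
               (λ p ry' adj → PathIn-snoc p (inS _ ry') adj)

  leave-interval : ∀ {a b x y} → InRange a b (index x) → ¬ InRange a b (index y) → CatAdj x y →
    Σ (Fin n) λ j → (y ≡ spine j) × ((toℕ j ≡ b) ⊎ (suc (toℕ j) ≡ a))
  leave-interval {a} {b} {x} (a≤x , x<b) y∉ adj with adjIndex adj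
  ... | inj₁ e = ⊥-elim (y∉ (subst (InRange a b) e (a≤x , x<b)))
  ... | inj₂ (inj₁ (j , refl , e)) = j , refl , inj₁ (≤-antisym j≤b (≮⇒≥ (λ j<b → y∉ (a≤j , j<b))))
    where
    a≤j : a ≤ toℕ j
    a≤j = ≤-trans a≤x (≤-trans (n≤1+n _) (≤-reflexive e))
    j≤b : toℕ j ≤ b
    j≤b = subst (_≤ b) e x<b
  ... | inj₂ (inj₂ (j , refl , e)) = j , refl , inj₂ (≤-antisym (≰⇒> (λ a≤j → y∉ (a≤j , j<b))) (subst (a ≤_) e a≤x))
    where
    j<b : toℕ j < b
    j<b = ≤-<-trans (n≤1+n _) (subst (_< b) e x<b)

  Side : ℕ → ℕ → ℕ → ℕ → Fin n → Set
  Side a b lo hi i' = ((a ≡ lo) × (b ≡ toℕ i')) ⊎ ((a ≡ suc (toℕ i')) × (b ≡ hi))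

  interval-isComponent : ∀ {S U : V → Set} {a b lo hi} (i' : Fin n) → InRange lo hi (toℕ i') → Side a b lo hi i' →
    (∀ y → S y → InRange a b (index y)) → (∀ y → InRange a b (index y) → S y) →
    (∀ y → U y → InRange lo hi (index y) × (y ≢ spine i')) → (∀ y → InRange lo hi (index y) → y ≢ spine i' → U y) →
    Σ V S → IsComponent G U S
  interval-isComponent {S} {U} {a} {b} {lo} {hi} i' (lo≤i' , i'<hi) side inS⇒ ⇒inS inU⇒ ⇒inU w =
    S⊆U , w , (λ x y sx sy → interval-path S ⇒inS x y (inS⇒ x sx) (inS⇒ y sy)) , closed
    where
    within : Side a b lo hi i' → ∀ {x} → InRange a b x → InRange lo hi x
    within (inj₁ (refl , refl)) (c , d) = c , <-trans d i'<hi
    within (inj₂ (refl , refl)) (c , d) = ≤-trans lo≤i' (≤-trans (n≤1+n _) c) , d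
    i'∉ : Side a b lo hi i' → ¬ InRange a b (toℕ i')
    i'∉ (inj₁ (refl , refl)) (c , d) = <-irrefl refl d
    i'∉ (inj₂ (refl , refl)) (c , d) = <-irrefl refl c
    S⊆U : ∀ x → S x → U x
    S⊆U x sx = ⇒inU x (within side (inS⇒ x sx)) λ { refl → i'∉ side (inS⇒ x sx) }
    closed : ∀ x y → S x → U y → ¬ S y → ¬ CatAdj x y
    closed x y sx uy y∉S adj with leave-interval (inS⇒ x sx) (λ r → y∉S (⇒inS y r)) adj | inU⇒ y uy
    ... | j , refl , j≡b | (lo≤j , j<hi) , j≢i' = boundary side j≡b
      where
      boundary : Side a b lo hi i' → (toℕ j ≡ b) ⊎ (suc (toℕ j) ≡ a) → ⊥
      boundary (inj₁ (_ , refl)) (inj₁ e) = j≢i' (cong spine (toℕ-injective e))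
      boundary (inj₁ (refl , _)) (inj₂ e) = <-irrefl refl (subst (_≤ toℕ j) (sym e) lo≤j)
      boundary (inj₂ (_ , refl)) (inj₁ e) = <-irrefl e j<hi
      boundary (inj₂ (refl , _)) (inj₂ e) = j≢i' (cong spine (toℕ-injective (suc-injective e)))

  path-stays-below : ∀ {S : V → Set} k → (∀ z → S z → z ≢ spine k) →
    ∀ {x y} → PathIn G S x y → index x < toℕ k → index y < toℕ k
  path-stays-below k nk (stop _) lt = lt
  path-stays-below {S} k nk (go {x} {z} sx adj rest) lt = path-stays-below k nk rest (next (adjIndex adj))
    where
    next : AdjIndex x z → index z < toℕ k
    next (inj₁ e) = subst (_< toℕ k) e lt
    next (inj₂ (inj₁ (j , refl , e))) with m≤n⇒m<n∨m≡n (subst (_≤ toℕ k) e lt)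
    ... | inj₁ jk = jk
    ... | inj₂ jk = ⊥-elim (nk (spine j) (PathIn-head rest) (cong spine (toℕ-injective jk)))
    next (inj₂ (inj₂ (j , refl , e))) = <-trans (n<1+n _) (subst (_< toℕ k) e lt)

  path-stays-above : ∀ {S : V → Set} k → (∀ z → S z → z ≢ spine k) →
    ∀ {x y} → PathIn G S x y → toℕ k < index x → toℕ k < index y
  path-stays-above k nk (stop _) lt = lt
  path-stays-above {S} k nk (go {x} {z} sx adj rest) lt = path-stays-above k nk rest (next (adjIndex adj))
    where
    next : AdjIndex x z → toℕ k < index z
    next (inj₁ e) = subst (toℕ k <_) e lt
    next (inj₂ (inj₁ (j , refl , e))) = <-trans lt (subst (index x <_) e (n<1+n _))
    next (inj₂ (inj₂ (j , refl , e))) with m≤n⇒m<n∨m≡n (≤-pred (subst (toℕ k <_) e lt))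
    ... | inj₁ kj = kj
    ... | inj₂ kj = ⊥-elim (nk (spine j) (PathIn-head rest) (cong spine (toℕ-injective (sym kj))))

  path-to-leg-via-spine : ∀ {S : V → Set} {x i j} → PathIn G S x (leg i j) → x ≢ leg i j → S (spine i)
  path-to-leg-via-spine (stop _) ne = ⊥-elim (ne refl)
  path-to-leg-via-spine {i = i} {j} (go {z = z} sx adj rest) ne with z ≟V leg i j
  path-to-leg-via-spine {i = i} {j} (go {z = .(leg i j)} sx (spine-leg .i .j) rest) ne | yes refl = sx
  ... | no nz = path-to-leg-via-spine rest nz

  data SpineBST : ℕ → ℕ → Set where
    leaf : ∀ {lo hi} → lo ≡ hi → SpineBST lo hi
    node : ∀ {lo hi} (k : Fin n) → SpineBST lo (toℕ k) → SpineBST (suc (toℕ k)) hi → SpineBST lo hi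

  bounds : ∀ {lo hi} → SpineBST lo hi → lo ≤ hi
  bounds (leaf refl) = ≤-refl
  bounds (node k l r) = ≤-trans (bounds l) (≤-trans (n≤1+n _) (bounds r))

  -- The parent of i in t, where q is the parent given to the root of t.
  parentIn : ∀ {lo hi} → SpineBST lo hi → Maybe (Fin n) → Fin n → Maybe (Fin n)
  parentIn (leaf _) q i = nothing
  parentIn (node k l r) q i with <-cmp (toℕ i) (toℕ k)
  ... | tri< _ _ _ = parentIn l (just k) i
  ... | tri≈ _ _ _ = q
  ... | tri> _ _ _ = parentIn r (just k) i

  module _ {lo hi} (k : Fin n) (l : SpineBST lo (toℕ k)) (r : SpineBST (suc (toℕ k)) hi) (q : Maybe (Fin n)) where
    parentIn-< : ∀ i → toℕ i < toℕ k → parentIn (node k l r) q i ≡ parentIn l (just k) i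
    parentIn-< i lt with <-cmp (toℕ i) (toℕ k)
    ... | tri< _ _ _ = refl
    ... | tri≈ _ e _ = ⊥-elim (<⇒≢ lt e)
    ... | tri> _ _ c = ⊥-elim (<-asym lt c)

    parentIn-≡ : ∀ i → toℕ i ≡ toℕ k → parentIn (node k l r) q i ≡ q
    parentIn-≡ i e with <-cmp (toℕ i) (toℕ k)
    ... | tri< a _ _ = ⊥-elim (<⇒≢ a e)
    ... | tri≈ _ _ _ = refl
    ... | tri> _ _ c = ⊥-elim (<⇒≢ c (sym e))

    parentIn-root : parentIn (node k l r) q k ≡ q
    parentIn-root = parentIn-≡ k refl

    parentIn-> : ∀ i → toℕ k < toℕ i → parentIn (node k l r) q i ≡ parentIn r (just k) i
    parentIn-> i gt with <-cmp (toℕ i) (toℕ k)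
    ... | tri< a _ _ = ⊥-elim (<-asym a gt)
    ... | tri≈ _ e _ = ⊥-elim (<⇒≢ gt (sym e))
    ... | tri> _ _ c = refl

  parentIn-ignores-left : ∀ {lo hi} k (l l' : SpineBST lo (toℕ k)) (r : SpineBST (suc (toℕ k)) hi) q i →
    ¬ toℕ i < toℕ k → parentIn (node k l r) q i ≡ parentIn (node k l' r) q i
  parentIn-ignores-left k l l' r q i i≮k with <-cmp (toℕ i) (toℕ k)
  ... | tri< lt _ _ = ⊥-elim (i≮k lt)
  ... | tri≈ _ _ _ = refl
  ... | tri> _ _ _ = refl

  parentIn-ignores-right : ∀ {lo hi} k (l : SpineBST lo (toℕ k)) (r r' : SpineBST (suc (toℕ k)) hi) q i →
    ¬ toℕ k < toℕ i → parentIn (node k l r) q i ≡ parentIn (node k l r') q i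
  parentIn-ignores-right k l r r' q i k≮i with <-cmp (toℕ i) (toℕ k)
  ... | tri< _ _ _ = refl
  ... | tri≈ _ _ _ = refl
  ... | tri> _ _ gt = ⊥-elim (k≮i gt)

  RootedAt : ∀ {lo hi} → SpineBST lo hi → Fin n → Set
  RootedAt {lo} {hi} t i = Σ (SpineBST lo (toℕ i)) λ l → Σ (SpineBST (suc (toℕ i)) hi) λ r → t ≡ node i l r

  ParentWithin : ℕ → ℕ → Maybe (Fin n) → Set
  ParentWithin a b p = Σ (Fin n) λ j → (p ≡ just j) × InRange a b (toℕ j)

  parentIn-nonRoot : ∀ {lo hi} (t : SpineBST lo hi) q q' i → ¬ RootedAt t i → parentIn t q i ≡ parentIn t q' i
  parentIn-nonRoot (leaf _) q q' i _ = refl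
  parentIn-nonRoot (node k l r) q q' i not-root with <-cmp (toℕ i) (toℕ k)
  ... | tri< _ _ _ = refl
  ... | tri> _ _ _ = refl
  ... | tri≈ _ e _ with toℕ-injective e
  ...   | refl = ⊥-elim (not-root (l , r , refl))

  root-or-inner : ∀ {lo hi} (t : SpineBST lo hi) q i → InRange lo hi (toℕ i) →
    RootedAt t i ⊎ ParentWithin lo hi (parentIn t q i)
  parentIn-left-within : ∀ {lo} k (l : SpineBST lo (toℕ k)) i → InRange lo (toℕ k) (toℕ i) →
    ParentWithin lo (suc (toℕ k)) (parentIn l (just k) i)
  parentIn-right-within : ∀ {hi} k (r : SpineBST (suc (toℕ k)) hi) i → InRange (suc (toℕ k)) hi (toℕ i) →
    ParentWithin (toℕ k) hi (parentIn r (just k) i)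

  root-or-inner (leaf refl) q i (a , b) = ⊥-elim (<-irrefl refl (≤-<-trans a b))
  root-or-inner (node k l r) q i (a , b) with <-cmp (toℕ i) (toℕ k)
  ... | tri≈ _ e _ with toℕ-injective e
  ...   | refl = inj₁ (l , r , refl)
  root-or-inner (node k l r) q i (a , b) | tri< lt _ _ with parentIn-left-within k l i (a , lt)
  ... | j , e , c , d = inj₂ (j , e , c , ≤-<-trans (≤-pred d) (bounds r))
  root-or-inner (node k l r) q i (a , b) | tri> _ _ gt with parentIn-right-within k r i (gt , b)
  ... | j , e , c , d = inj₂ (j , e , ≤-trans (bounds l) c , d)

  parentIn-left-within k l i ri with root-or-inner l (just k) i ri
  ... | inj₁ (l' , r' , refl) = k , parentIn-root i l' r' (just k) , bounds l , n<1+n _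
  ... | inj₂ (j , e , c , d) = j , e , c , <-trans d (n<1+n _)

  parentIn-right-within k r i ri with root-or-inner r (just k) i ri
  ... | inj₁ (l' , r' , refl) = k , parentIn-root i l' r' (just k) , ≤-refl , bounds r
  ... | inj₂ (j , e , c , d) = j , e , <⇒≤ c , d

  parentIn-outside⇒root : ∀ {lo hi} (t : SpineBST lo hi) (i j : Fin n) → InRange lo hi (toℕ i) → ¬ InRange lo hi (toℕ j) →
    parentIn t (just j) i ≡ just j → RootedAt t i
  parentIn-outside⇒root t i j ri j∉ e with root-or-inner t (just j) i ri
  ... | inj₁ root = root
  ... | inj₂ (j' , e' , rj') with trans (sym e') e
  ...   | refl = ⊥-elim (j∉ rj')

  OutOfRange : ℕ → ℕ → Maybe (Fin n) → Set
  OutOfRange lo hi q = ∀ j → q ≡ just j → ¬ InRange lo hi (toℕ j)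

  OutOfRange-mono : ∀ {lo hi lo' hi' q} → lo' ≤ lo → hi ≤ hi' → OutOfRange lo' hi' q → OutOfRange lo hi q
  OutOfRange-mono a b o j e (c , d) = o j e (≤-trans a c , <-≤-trans d b)

  within⇒OutOfRange : ∀ {a b lo hi p} → (∀ {x} → InRange a b x → ¬ InRange lo hi x) → ParentWithin a b p → OutOfRange lo hi p
  within⇒OutOfRange disjoint (j , refl , rj) .j refl = disjoint rj

  -- One-hole contexts of SpineBST 0 n: Context lo hi q is the rest of a tree
  -- around a subtree on [lo, hi) whose root has parent q.
  data Context : ℕ → ℕ → Maybe (Fin n) → Set where
    top     : Context 0 n nothing
    inLeft  : ∀ {lo hi q} (k : Fin n) → SpineBST (suc (toℕ k)) hi → Context lo hi q → Context lo (toℕ k) (just k)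
    inRight : ∀ {lo hi q} (k : Fin n) → SpineBST lo (toℕ k) → Context lo hi q → Context (suc (toℕ k)) hi (just k)

  plug : ∀ {lo hi q} → Context lo hi q → SpineBST lo hi → SpineBST 0 n
  plug top s = s
  plug (inLeft k r C) s = plug C (node k s r)
  plug (inRight k l C) s = plug C (node k l s)

  context-outOfRange : ∀ {lo hi q} → Context lo hi q → OutOfRange lo hi q
  context-outOfRange (inLeft k r C) j refl (a , b) = <-irrefl refl b
  context-outOfRange (inRight k l C) j refl (a , b) = <-irrefl refl a

  plug-inRange : ∀ {lo hi q} (C : Context lo hi q) (s : SpineBST lo hi) i → InRange lo hi (toℕ i) →
    parentIn (plug C s) nothing i ≡ parentIn s q i
  plug-inRange top s i _ = refl
  plug-inRange (inLeft k r C) s i (a , b) =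
    trans (plug-inRange C (node k s r) i (a , <-trans b (bounds r))) (parentIn-< k s r _ i b)
  plug-inRange (inRight k l C) s i (a , b) =
    trans (plug-inRange C (node k l s) i (≤-trans (bounds l) (≤-trans (n≤1+n _) a) , b)) (parentIn-> k l s _ i a)

  plug-outOfRange : ∀ {lo hi q} (C : Context lo hi q) (s s' : SpineBST lo hi) i → ¬ InRange lo hi (toℕ i) →
    parentIn (plug C s) nothing i ≡ parentIn (plug C s') nothing i
  plug-outOfRange top s s' i i∉ = ⊥-elim (i∉ (z≤n , toℕ<n i))
  plug-outOfRange {lo} (inLeft {hi = hi} k r C) s s' i i∉ with inRange? lo hi (toℕ i)
  ... | no g = plug-outOfRange C (node k s r) (node k s' r) i g
  ... | yes ri = begin
    parentIn (plug C (node k s r)) nothing i  ≡⟨ plug-inRange C _ i ri ⟩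
    parentIn (node k s r) _ i                 ≡⟨ parentIn-ignores-left k s s' r _ i (λ lt → i∉ (proj₁ ri , lt)) ⟩
    parentIn (node k s' r) _ i                ≡⟨ plug-inRange C _ i ri ⟨
    parentIn (plug C (node k s' r)) nothing i ∎
    where open ≡-Reasoning
  plug-outOfRange {hi = hi} (inRight {lo = lo} k l C) s s' i i∉ with inRange? lo hi (toℕ i)
  ... | no g = plug-outOfRange C (node k l s) (node k l s') i g
  ... | yes ri = begin
    parentIn (plug C (node k l s)) nothing i  ≡⟨ plug-inRange C _ i ri ⟩
    parentIn (node k l s) _ i                 ≡⟨ parentIn-ignores-right k l s s' _ i (λ gt → i∉ (gt , proj₂ ri)) ⟩
    parentIn (node k l s') _ i                ≡⟨ plug-inRange C _ i ri ⟨
    parentIn (plug C (node k l s')) nothing i ∎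
    where open ≡-Reasoning

  plug-outOfRange-parent : ∀ {lo hi q} (C : Context lo hi q) (s : SpineBST lo hi) i → ¬ InRange lo hi (toℕ i) →
    OutOfRange lo hi (parentIn (plug C s) nothing i)
  plug-outOfRange-parent top s i i∉ = ⊥-elim (i∉ (z≤n , toℕ<n i))
  plug-outOfRange-parent {lo} (inLeft {hi = hi} {q = q} k r C) s i i∉ with inRange? lo hi (toℕ i)
  ... | no g = OutOfRange-mono ≤-refl (<⇒≤ (bounds r)) (plug-outOfRange-parent C (node k s r) i g)
  ... | yes ri = subst (OutOfRange lo (toℕ k)) (sym (plug-inRange C (node k s r) i ri)) (local (<-cmp (toℕ i) (toℕ k)))
    where
    local : Tri (toℕ i < toℕ k) (toℕ i ≡ toℕ k) (toℕ k < toℕ i) → OutOfRange lo (toℕ k) (parentIn (node k s r) q i)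
    local (tri< lt _ _) = ⊥-elim (i∉ (proj₁ ri , lt))
    local (tri≈ _ e _) = subst (OutOfRange lo (toℕ k)) (sym (parentIn-≡ k s r q i e))
                           (OutOfRange-mono ≤-refl (<⇒≤ (bounds r)) (context-outOfRange C))
    local (tri> _ _ gt) = subst (OutOfRange lo (toℕ k)) (sym (parentIn-> k s r q i gt))
                            (within⇒OutOfRange (λ x y → <-irrefl refl (<-≤-trans (proj₂ y) (proj₁ x)))
                              (parentIn-right-within k r i (gt , proj₂ ri)))
  plug-outOfRange-parent {hi = hi} (inRight {lo = lo} {q = q} k l C) s i i∉ with inRange? lo hi (toℕ i)
  ... | no g = OutOfRange-mono (≤-trans (bounds l) (n≤1+n _)) ≤-refl (plug-outOfRange-parent C (node k l s) i g)
  ... | yes ri = subst (OutOfRange (suc (toℕ k)) hi) (sym (plug-inRange C (node k l s) i ri)) (local (<-cmp (toℕ i) (toℕ k)))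
    where
    local : Tri (toℕ i < toℕ k) (toℕ i ≡ toℕ k) (toℕ k < toℕ i) → OutOfRange (suc (toℕ k)) hi (parentIn (node k l s) q i)
    local (tri> _ _ gt) = ⊥-elim (i∉ (gt , proj₂ ri))
    local (tri≈ _ e _) = subst (OutOfRange (suc (toℕ k)) hi) (sym (parentIn-≡ k l s q i e))
                           (OutOfRange-mono (≤-trans (bounds l) (n≤1+n _)) ≤-refl (context-outOfRange C))
    local (tri< lt _ _) = subst (OutOfRange (suc (toℕ k)) hi) (sym (parentIn-< k l s q i lt))
                            (within⇒OutOfRange (λ x y → <-irrefl refl (<-≤-trans (proj₂ x) (proj₁ y)))
                              (parentIn-left-within k l i (proj₁ ri , lt)))

  mapSpine : Maybe (Fin n) → Maybe V
  mapSpine = Maybe.map spine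

  mapSpine-injective : ∀ x j → mapSpine x ≡ just (spine j) → x ≡ just j
  mapSpine-injective (just x) j refl = refl

  just-spine-injective : ∀ {i j : Fin n} → _≡_ {A = Maybe V} (just (spine i)) (just (spine j)) → i ≡ j
  just-spine-injective refl = refl

  toParent : SpineBST 0 n → Parent G
  toParent t (spine i) = mapSpine (parentIn t nothing i)
  toParent t (leg i _) = just (spine i)

  toParent-spine : ∀ t i x → toParent t (spine i) ≡ just x → Σ (Fin n) λ j → (x ≡ spine j) × (parentIn t nothing i ≡ just j)
  toParent-spine t i x e with parentIn t nothing i
  toParent-spine t i x refl | just j = j , refl , refl

  toParent-leftChild : ∀ {lo hi q} (C : Context lo hi q) k k' (l' : SpineBST lo (toℕ k')) r' (r : SpineBST (suc (toℕ k)) hi) →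
    toParent (plug C (node k (node k' l' r') r)) (spine k') ≡ just (spine k)
  toParent-leftChild C k k' l' r' r = cong mapSpine (begin
    parentIn (plug C (node k (node k' l' r') r)) nothing k' ≡⟨ plug-inRange C _ k' (bounds l' , <-trans (bounds r') (bounds r)) ⟩
    parentIn (node k (node k' l' r') r) _ k'               ≡⟨ parentIn-< k (node k' l' r') r _ k' (bounds r') ⟩
    parentIn (node k' l' r') (just k) k'                   ≡⟨ parentIn-root k' l' r' (just k) ⟩
    just k                                                  ∎)
    where open ≡-Reasoning

  toParent-rightChild : ∀ {lo hi q} (C : Context lo hi q) k k' (l : SpineBST lo (toℕ k)) (l' : SpineBST (suc (toℕ k)) (toℕ k')) r' →
    toParent (plug C (node k l (node k' l' r'))) (spine k') ≡ just (spine k)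
  toParent-rightChild C k k' l l' r' = cong mapSpine (begin
    parentIn (plug C (node k l (node k' l' r'))) nothing k' ≡⟨ plug-inRange C _ k' (≤-trans (bounds l) (≤-trans (n≤1+n _) (bounds l')) , bounds r') ⟩
    parentIn (node k l (node k' l' r')) _ k'               ≡⟨ parentIn-> k l (node k' l' r') _ k' (bounds l') ⟩
    parentIn (node k' l' r') (just k) k'                   ≡⟨ parentIn-root k' l' r' (just k) ⟩
    just k                                                  ∎)
    where open ≡-Reasoning

  spine-inRange⇒descendant : ∀ {lo hi q} (C : Context lo hi q) k (l : SpineBST lo (toℕ k)) (r : SpineBST (suc (toℕ k)) hi) →
    ∀ i → InRange lo hi (toℕ i) → Anc G (toParent (plug C (node k l r))) (spine k) (spine i)
  spine-inRange⇒descendant C k l r i (a , b) with <-cmp (toℕ i) (toℕ k)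
  ... | tri≈ _ e _ rewrite toℕ-injective e = here
  spine-inRange⇒descendant C k (leaf e) r i (a , b) | tri< lt _ _ =
    ⊥-elim (<-irrefl refl (<-≤-trans lt (subst (_≤ toℕ i) e a)))
  spine-inRange⇒descendant C k (node k' l' r') r i (a , b) | tri< lt _ _ =
    Anc-trans (there (toParent-leftChild C k k' l' r' r) here) (spine-inRange⇒descendant (inLeft k r C) k' l' r' i (a , lt))
  spine-inRange⇒descendant C k l (leaf e) i (a , b) | tri> _ _ gt =
    ⊥-elim (<-irrefl refl (<-≤-trans b (subst (_≤ toℕ i) e gt)))
  spine-inRange⇒descendant C k l (node k' l' r') i (a , b) | tri> _ _ gt =
    Anc-trans (there (toParent-rightChild C k k' l l' r') here) (spine-inRange⇒descendant (inRight k l C) k' l' r' i (gt , b))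

  inRange⇒descendant : ∀ {lo hi q} (C : Context lo hi q) k (l : SpineBST lo (toℕ k)) (r : SpineBST (suc (toℕ k)) hi) →
    ∀ y → InRange lo hi (index y) → Anc G (toParent (plug C (node k l r))) (spine k) y
  inRange⇒descendant C k l r (leg i j) ri = there refl (spine-inRange⇒descendant C k l r i ri)
  inRange⇒descendant C k l r (spine i) ri = spine-inRange⇒descendant C k l r i ri

  descendant⇒inRange : ∀ {lo hi q} (C : Context lo hi q) k (l : SpineBST lo (toℕ k)) (r : SpineBST (suc (toℕ k)) hi) →
    ∀ {y} → Anc G (toParent (plug C (node k l r))) (spine k) y → InRange lo hi (index y)
  descendant⇒inRange C k l r here = bounds l , bounds r
  descendant⇒inRange C k l r (there {y = leg i j} refl d) = descendant⇒inRange C k l r d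
  descendant⇒inRange {lo} {hi} C k l r (there {x} {spine i} e d) with inRange? lo hi (toℕ i)
  ... | yes ri = ri
  ... | no i∉ with toParent-spine (plug C (node k l r)) i x e
  ...   | j , refl , e' = ⊥-elim (plug-outOfRange-parent C (node k l r) i i∉ j e' (descendant⇒inRange C k l r d))

  record Site (t : SpineBST 0 n) (i : Fin n) : Set where
    constructor site
    field
      {lo hi} : ℕ
      {q} : Maybe (Fin n)
      context : Context lo hi q
      left : SpineBST lo (toℕ i)
      right : SpineBST (suc (toℕ i)) hi
      plugged : plug context (node i left right) ≡ t

  find-site : ∀ {lo hi q} (C : Context lo hi q) (s : SpineBST lo hi) i → InRange lo hi (toℕ i) → Site (plug C s) i
  find-site C (leaf e) i (a , b) = ⊥-elim (<-irrefl refl (<-≤-trans b (subst (_≤ toℕ i) e a)))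
  find-site C (node k l r) i (a , b) with <-cmp (toℕ i) (toℕ k)
  ... | tri≈ _ e _ with toℕ-injective e
  ...   | refl = site C l r refl
  find-site C (node k l r) i (a , b) | tri< lt _ _ = find-site (inLeft k r C) l i (a , lt)
  find-site C (node k l r) i (a , b) | tri> _ _ gt = find-site (inRight k l C) r i (gt , b)

  leg-descendant : ∀ t {i j y} → Anc G (toParent t) (leg i j) y → y ≡ leg i j
  leg-descendant t here = refl
  leg-descendant t (there {y = y} e d) with leg-descendant t d
  leg-descendant t (there {y = spine i'} e d) | refl with toParent-spine t i' _ e
  ... | _ , () , _
  leg-descendant t (there {y = leg _ _} () d) | refl

  leg-component : ∀ t i j → IsComponent G (λ x → Anc G (toParent t) (spine i) x × (x ≢ spine i)) (Anc G (toParent t) (leg i j))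
  leg-component t i j = inside , (leg i j , here) , path , closed
    where
    inside : ∀ x → Anc G (toParent t) (leg i j) x → Anc G (toParent t) (spine i) x × (x ≢ spine i)
    inside x d with leg-descendant t d
    ... | refl = there refl here , λ ()
    path : ∀ x y → Anc G (toParent t) (leg i j) x → Anc G (toParent t) (leg i j) y → PathIn G (Anc G (toParent t) (leg i j)) x y
    path x y dx dy with leg-descendant t dx | leg-descendant t dy
    ... | refl | refl = stop here
    closed : ∀ x y → Anc G (toParent t) (leg i j) x → Anc G (toParent t) (spine i) y × (y ≢ spine i) →
             ¬ Anc G (toParent t) (leg i j) y → ¬ CatAdj x y
    closed x y dx uy _ adj with leg-descendant t dx
    closed x .(spine i) dx uy _ (leg-spine .i .j) | refl = proj₂ uy refl

  -- The subtree of a child of i' is the part [lo, i') or [i'+1, hi) of the range [lo, hi) of i'.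
  spine-component : ∀ t i i' → toParent t (spine i) ≡ just (spine i') →
    IsComponent G (λ x → Anc G (toParent t) (spine i') x × (x ≢ spine i')) (Anc G (toParent t) (spine i))
  spine-component t i i' e with toParent-spine t i _ e
  ... | .i' , refl , e' with find-site top t i' (z≤n , toℕ<n i')
  ... | site {lo} {hi} {q} C l r refl with inRange? lo hi (toℕ i)
  ...   | no i∉ = ⊥-elim (plug-outOfRange-parent C (node i' l r) i i∉ i' e' (bounds l , bounds r))
  ...   | yes ri = by-side (<-cmp (toℕ i) (toℕ i'))
    where
    P : Parent G
    P = toParent (plug C (node i' l r))
    parent-in-node : parentIn (node i' l r) q i ≡ just i'
    parent-in-node = trans (sym (plug-inRange C _ i ri)) e'
    U : V → Set
    U x = Anc G P (spine i') x × (x ≢ spine i')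
    U⇒ : ∀ y → U y → InRange lo hi (index y) × (y ≢ spine i')
    U⇒ y u = descendant⇒inRange C i' l r (proj₁ u) , proj₂ u
    ⇒U : ∀ y → InRange lo hi (index y) → y ≢ spine i' → U y
    ⇒U y ry ne = inRange⇒descendant C i' l r y ry , ne
    by-side : Tri (toℕ i < toℕ i') (toℕ i ≡ toℕ i') (toℕ i' < toℕ i) → IsComponent G U (Anc G P (spine i))
    by-side (tri≈ _ i≡i' _) =
      ⊥-elim (context-outOfRange C i' (trans (sym (parentIn-≡ i' l r q i i≡i')) parent-in-node) (bounds l , bounds r))
    by-side (tri< lt _ _)
      with parentIn-outside⇒root l i i' (proj₁ ri , lt) (λ z → <-irrefl refl (proj₂ z)) (trans (sym (parentIn-< i' l r q i lt)) parent-in-node)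
    ... | l' , r' , refl =
      interval-isComponent i' (bounds l , bounds r) (inj₁ (refl , refl))
        (λ y → descendant⇒inRange (inLeft i' r C) i l' r') (inRange⇒descendant (inLeft i' r C) i l' r') U⇒ ⇒U (spine i , here)
    by-side (tri> _ _ gt)
      with parentIn-outside⇒root r i i' (gt , proj₂ ri) (λ z → <-irrefl refl (proj₁ z)) (trans (sym (parentIn-> i' l r q i gt)) parent-in-node)
    ... | l' , r' , refl =
      interval-isComponent i' (bounds l , bounds r) (inj₂ (refl , refl))
        (λ y → descendant⇒inRange (inRight i' l C) i l' r') (inRange⇒descendant (inRight i' l C) i l' r') U⇒ ⇒U (spine i , here)

  toParent-isSearchTree : (t : SpineBST 0 n) → 0 < n → IsSearchTree G (toParent t)
  toParent-isSearchTree (leaf refl) ()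
  toParent-isSearchTree t@(node k l r) _ =
    spine k , (cong mapSpine (parentIn-root k l r nothing) , λ v → inRange⇒descendant top k l r v (z≤n , index<n v)) , component
    where
    component : ∀ v c → toParent t c ≡ just v → IsComponent G (λ x → Anc G (toParent t) v x × (x ≢ v)) (Anc G (toParent t) c)
    component v (leg i j) refl = leg-component t i j
    component v (spine i) e with toParent-spine t i v e
    ... | i' , refl , _ = spine-component t i i' e

  RotationCase : Parent G → Parent G → V → V → V → Set
  RotationCase P P' x c p = ((P' x ≡ P x) × (P x ≡ just c → ¬ SubtreeAdj G P x p))
                          ⊎ ((P x ≡ just c) × (P' x ≡ just p) × SubtreeAdj G P x p)

  RotationCase⇒clauses : ∀ {P P' x c p} → RotationCase P P' x c p →
    (P x ≡ just c → (SubtreeAdj G P x p → P' x ≡ just p) × (¬ SubtreeAdj G P x p → P' x ≡ P x))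
    × (P x ≢ just c → P' x ≡ P x)
  RotationCase⇒clauses (inj₁ (e , ¬adj)) = (λ pc → (λ adj → ⊥-elim (¬adj pc adj)) , λ _ → e) , λ _ → e
  RotationCase⇒clauses (inj₂ (pc , e' , adj)) = (λ _ → (λ _ → e') , λ ¬adj → ⊥-elim (¬adj adj)) , λ ¬pc → ⊥-elim (¬pc pc)

  leg-¬SubtreeAdj : ∀ t i j p → i ≢ p → ¬ SubtreeAdj G (toParent t) (leg i j) (spine p)
  leg-¬SubtreeAdj t i j p ne (y , d , adj) with leg-descendant t d
  ... | refl with adj
  ... | leg-spine _ _ = ne refl

  below-¬SubtreeAdj : ∀ {P x} p bound → suc bound ≤ toℕ p → (∀ y → Anc G P x y → index y < bound) → ¬ SubtreeAdj G P x (spine p)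
  below-¬SubtreeAdj p bound lt below (y , d , adj) with below y d | adjIndex adj
  ... | h | inj₁ e = <-irrefl refl (<-trans (subst (_< bound) e h) lt)
  ... | h | inj₂ (inj₁ (_ , refl , e)) = <-irrefl refl (≤-<-trans (subst (_≤ bound) e h) lt)
  ... | h | inj₂ (inj₂ (_ , refl , e)) = <-irrefl refl (<-trans (n<1+n _) (<-trans (subst (_< bound) e h) lt))

  above-¬SubtreeAdj : ∀ {P x} p bound → suc (toℕ p) < bound → (∀ y → Anc G P x y → bound ≤ index y) → ¬ SubtreeAdj G P x (spine p)
  above-¬SubtreeAdj p bound lt above (y , d , adj) with above y d | adjIndex adj
  ... | h | inj₁ e = <-irrefl refl (<-≤-trans (<-trans (n<1+n _) lt) (subst (bound ≤_) e h))
  ... | h | inj₂ (inj₁ (_ , refl , e)) = <-irrefl refl (<-trans (<-trans (n<1+n _) lt) (subst (bound <_) e (≤-<-trans h (n<1+n _))))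
  ... | h | inj₂ (inj₂ (_ , refl , e)) = <-irrefl refl (<-≤-trans lt (subst (bound ≤_) e h))

  -- Exchanging the subtree rooted at p for one rooted at c on the same range is a
  -- rotation at (p, c) as soon as the vertices of the range are handled: legs and
  -- vertices outside the range keep their parents.
  rotation-in-context : ∀ {lo hi q} (C : Context lo hi q) (p c : Fin n)
    (l : SpineBST lo (toℕ p)) (r : SpineBST (suc (toℕ p)) hi) (l' : SpineBST lo (toℕ c)) (r' : SpineBST (suc (toℕ c)) hi) →
    c ≢ p →
    toParent (plug C (node p l r)) (spine c) ≡ just (spine p) →
    toParent (plug C (node c l' r')) (spine p) ≡ just (spine c) →
    (∀ i → InRange lo hi (toℕ i) → i ≢ c → i ≢ p →
       RotationCase (toParent (plug C (node p l r))) (toParent (plug C (node c l' r'))) (spine i) (spine c) (spine p)) →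
    RotationAt G (toParent (plug C (node p l r))) (toParent (plug C (node c l' r'))) (spine p) (spine c)
  rotation-in-context {lo} {hi} {q} C p c l r l' r' c≢p c-child p-child inside =
    c-child , parent-of-root , p-child , λ x x≢c x≢p → RotationCase⇒clauses {P} {P'} (by-vertex x x≢c x≢p)
    where
    s s' : SpineBST lo hi
    s = node p l r
    s' = node c l' r'
    P P' : Parent G
    P = toParent (plug C s)
    P' = toParent (plug C s')
    parent-of-root : P' (spine c) ≡ P (spine p)
    parent-of-root = cong mapSpine (begin
      parentIn (plug C s') nothing c ≡⟨ plug-inRange C s' c (bounds l' , bounds r') ⟩
      parentIn s' q c                ≡⟨ parentIn-root c l' r' q ⟩
      q                              ≡⟨ parentIn-root p l r q ⟨
      parentIn s q p                 ≡⟨ plug-inRange C s p (bounds l , bounds r) ⟨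
      parentIn (plug C s) nothing p  ∎)
      where open ≡-Reasoning
    by-vertex : ∀ x → x ≢ spine c → x ≢ spine p → RotationCase P P' x (spine c) (spine p)
    by-vertex (leg i j) _ _ = inj₁ (refl , λ e → leg-¬SubtreeAdj (plug C s) i j p (λ i≡p → c≢p (trans (sym (just-spine-injective e)) i≡p)))
    by-vertex (spine i) x≢c x≢p with inRange? lo hi (toℕ i)
    ... | yes ri = inside i ri (λ e → x≢c (cong spine e)) (λ e → x≢p (cong spine e))
    ... | no i∉ = inj₁ (cong mapSpine (plug-outOfRange C s' s i i∉) ,
                        λ e → ⊥-elim (plug-outOfRange-parent C s i i∉ c (mapSpine-injective _ c e) (bounds l' , bounds r')))

  parentIn-rootedAt : ∀ {lo hi} (t : SpineBST lo hi) q i → RootedAt t i → parentIn t q i ≡ q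
  parentIn-rootedAt t q i (l , r , refl) = parentIn-root i l r q

  previous : (k : Fin n) → ∀ {i} → i < toℕ k → Σ (Fin n) λ k' → (suc (toℕ k') ≡ toℕ k) × (i ≤ toℕ k')
  previous k {i} i<k with toℕ k | toℕ<n k | i<k
  ... | suc x | x<n | s≤s i≤x = fromℕ< (<-trans (n<1+n x) x<n) , cong suc (toℕ-fromℕ< _) , subst (i ≤_) (sym (toℕ-fromℕ< _)) i≤x

  next : (j : Fin n) → ∀ {i} → toℕ j < i → i < n → Σ (Fin n) λ j' → (toℕ j' ≡ suc (toℕ j)) × (toℕ j' ≤ i)
  next j j<i i<n = fromℕ< (≤-<-trans j<i i<n) , toℕ-fromℕ< _ , subst (_≤ _) (sym (toℕ-fromℕ< _)) j<i

  module RightRotation {lo hi q} (C : Context lo hi q) (k j : Fin n)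
    (a : SpineBST lo (toℕ j)) (b : SpineBST (suc (toℕ j)) (toℕ k)) (r : SpineBST (suc (toℕ k)) hi) where

    s s' : SpineBST lo hi
    s = node k (node j a b) r
    s' = node j a (node k b r)

    P P' : Parent G
    P = toParent (plug C s)
    P' = toParent (plug C s')

    j<k : toℕ j < toℕ k
    j<k = bounds b

    parent-unchanged : ∀ i → InRange lo hi (toℕ i) → parentIn s' q i ≡ parentIn s q i → P' (spine i) ≡ P (spine i)
    parent-unchanged i ri e = cong mapSpine (trans (plug-inRange C s' i ri) (trans e (sym (plug-inRange C s i ri))))

    parent-is-j : ∀ i → InRange lo hi (toℕ i) → P (spine i) ≡ just (spine j) → parentIn s q i ≡ just j
    parent-is-j i ri e = trans (sym (plug-inRange C s i ri)) (mapSpine-injective _ j e)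

    in-a : ∀ i → InRange lo (toℕ j) (toℕ i) → InRange lo hi (toℕ i) → RotationCase P P' (spine i) (spine j) (spine k)
    in-a i (lo≤i , i<j) ri = inj₁ (parent-unchanged i ri (trans e' (sym e)) , ¬adj)
      where
      e : parentIn s q i ≡ parentIn a (just j) i
      e = trans (parentIn-< k (node j a b) r q i (<-trans i<j j<k)) (parentIn-< j a b (just k) i i<j)
      e' : parentIn s' q i ≡ parentIn a (just j) i
      e' = parentIn-< j a (node k b r) q i i<j
      ¬adj : P (spine i) ≡ just (spine j) → ¬ SubtreeAdj G P (spine i) (spine k)
      ¬adj pc with parentIn-outside⇒root a i j (lo≤i , i<j) (λ z → <-irrefl refl (proj₂ z)) (trans (sym e) (parent-is-j i ri pc))
      ... | a₁ , a₂ , refl =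
        below-¬SubtreeAdj k (toℕ j) j<k (λ y d → proj₂ (descendant⇒inRange (inLeft j b (inLeft k r C)) i a₁ a₂ d))

    -- The root of b is the only vertex that moves: its subtree contains spine (k-1).
    in-b : ∀ i → InRange (suc (toℕ j)) (toℕ k) (toℕ i) → InRange lo hi (toℕ i) → RotationCase P P' (spine i) (spine j) (spine k)
    in-b i (j<i , i<k) ri with root-or-inner b (just j) i (j<i , i<k)
    ... | inj₁ (b₁ , b₂ , refl) = inj₂ (cong mapSpine (trans (plug-inRange C s i ri) e) , cong mapSpine (trans (plug-inRange C s' i ri) e') , adj)
      where
      e : parentIn s q i ≡ just j
      e = trans (parentIn-< k (node j a b) r q i i<k) (trans (parentIn-> j a b (just k) i j<i) (parentIn-root i b₁ b₂ (just j)))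
      e' : parentIn s' q i ≡ just k
      e' = trans (parentIn-> j a (node k b r) q i j<i) (trans (parentIn-< k b r (just j) i i<k) (parentIn-root i b₁ b₂ (just k)))
      adj : SubtreeAdj G P (spine i) (spine k)
      adj with previous k i<k
      ... | k' , k'+1≡k , i≤k' = spine k' , inRange⇒descendant (inRight j a (inLeft k r C)) i b₁ b₂ (spine k') (≤-trans j<i i≤k' , ≤-reflexive k'+1≡k) , spine-next k' k k'+1≡k
    ... | inj₂ (j' , e₁ , j<j' , _) = inj₁ (parent-unchanged i ri (trans e' (trans (parentIn-nonRoot b (just k) (just j) i ¬root) (sym e))) , ¬pc)
      where
      e : parentIn s q i ≡ parentIn b (just j) i
      e = trans (parentIn-< k (node j a b) r q i i<k) (parentIn-> j a b (just k) i j<i)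
      e' : parentIn s' q i ≡ parentIn b (just k) i
      e' = trans (parentIn-> j a (node k b r) q i j<i) (parentIn-< k b r (just j) i i<k)
      j≢j' : just j ≢ just j'
      j≢j' jj' = <-irrefl (cong toℕ (just-injective jj')) j<j'
      ¬root : ¬ RootedAt b i
      ¬root rt = j≢j' (trans (sym (parentIn-rootedAt b (just j) i rt)) e₁)
      ¬pc : P (spine i) ≡ just (spine j) → ¬ SubtreeAdj G P (spine i) (spine k)
      ¬pc pc _ = j≢j' (trans (sym (parent-is-j i ri pc)) (trans e e₁))

    in-r : ∀ i → toℕ k < toℕ i → InRange lo hi (toℕ i) → RotationCase P P' (spine i) (spine j) (spine k)
    in-r i k<i ri = inj₁ (parent-unchanged i ri (trans e' (sym e)) , ¬pc)
      where
      e : parentIn s q i ≡ parentIn r (just k) i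
      e = parentIn-> k (node j a b) r q i k<i
      e' : parentIn s' q i ≡ parentIn r (just k) i
      e' = trans (parentIn-> j a (node k b r) q i (<-trans j<k k<i)) (parentIn-> k b r (just j) i k<i)
      ¬pc : P (spine i) ≡ just (spine j) → ¬ SubtreeAdj G P (spine i) (spine k)
      ¬pc pc _ with parentIn-right-within k r i (k<i , proj₂ ri)
      ... | j' , e₁ , k≤j' , _ with trans (sym (trans e e₁)) (parent-is-j i ri pc)
      ...   | refl = <-irrefl refl (<-≤-trans j<k k≤j')

    isRotation : RotationAt G P P' (spine k) (spine j)
    isRotation = rotation-in-context C k j (node j a b) r a (node k b r) (λ e → <-irrefl (cong toℕ e) j<k)
                   (toParent-leftChild C k j a b r) (toParent-rightChild C j k a b r) inside
      where
      inside : ∀ i → InRange lo hi (toℕ i) → i ≢ j → i ≢ k → RotationCase P P' (spine i) (spine j) (spine k)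
      inside i ri i≢j i≢k with <-cmp (toℕ i) (toℕ j) | <-cmp (toℕ i) (toℕ k)
      ... | tri< i<j _ _ | _ = in-a i (proj₁ ri , i<j) ri
      ... | tri≈ _ e _ | _ = ⊥-elim (i≢j (toℕ-injective e))
      ... | tri> _ _ j<i | tri< i<k _ _ = in-b i (j<i , i<k) ri
      ... | tri> _ _ _ | tri≈ _ e _ = ⊥-elim (i≢k (toℕ-injective e))
      ... | tri> _ _ _ | tri> _ _ k<i = in-r i k<i ri

  module LeftRotation {lo hi q} (C : Context lo hi q) (j k : Fin n)
    (a : SpineBST lo (toℕ j)) (b : SpineBST (suc (toℕ j)) (toℕ k)) (r : SpineBST (suc (toℕ k)) hi) where

    s s' : SpineBST lo hi
    s = node j a (node k b r)
    s' = node k (node j a b) r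

    P P' : Parent G
    P = toParent (plug C s)
    P' = toParent (plug C s')

    j<k : toℕ j < toℕ k
    j<k = bounds b

    parent-unchanged : ∀ i → InRange lo hi (toℕ i) → parentIn s' q i ≡ parentIn s q i → P' (spine i) ≡ P (spine i)
    parent-unchanged i ri e = cong mapSpine (trans (plug-inRange C s' i ri) (trans e (sym (plug-inRange C s i ri))))

    parent-is-k : ∀ i → InRange lo hi (toℕ i) → P (spine i) ≡ just (spine k) → parentIn s q i ≡ just k
    parent-is-k i ri e = trans (sym (plug-inRange C s i ri)) (mapSpine-injective _ k e)

    in-a : ∀ i → toℕ i < toℕ j → InRange lo hi (toℕ i) → RotationCase P P' (spine i) (spine k) (spine j)
    in-a i i<j ri = inj₁ (parent-unchanged i ri (trans e' (sym e)) , ¬pc)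
      where
      e : parentIn s q i ≡ parentIn a (just j) i
      e = parentIn-< j a (node k b r) q i i<j
      e' : parentIn s' q i ≡ parentIn a (just j) i
      e' = trans (parentIn-< k (node j a b) r q i (<-trans i<j j<k)) (parentIn-< j a b (just k) i i<j)
      ¬pc : P (spine i) ≡ just (spine k) → ¬ SubtreeAdj G P (spine i) (spine j)
      ¬pc pc _ with parentIn-left-within j a i (proj₁ ri , i<j)
      ... | j' , e₁ , _ , j'≤j with trans (sym (trans e e₁)) (parent-is-k i ri pc)
      ...   | refl = <-irrefl refl (<-≤-trans j<k (≤-pred j'≤j))

    -- The root of b is the only vertex that moves: its subtree contains spine (j+1).
    in-b : ∀ i → InRange (suc (toℕ j)) (toℕ k) (toℕ i) → InRange lo hi (toℕ i) → RotationCase P P' (spine i) (spine k) (spine j)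
    in-b i (j<i , i<k) ri with root-or-inner b (just k) i (j<i , i<k)
    ... | inj₁ (b₁ , b₂ , refl) = inj₂ (cong mapSpine (trans (plug-inRange C s i ri) e) , cong mapSpine (trans (plug-inRange C s' i ri) e') , adj)
      where
      e : parentIn s q i ≡ just k
      e = trans (parentIn-> j a (node k b r) q i j<i) (trans (parentIn-< k b r (just j) i i<k) (parentIn-root i b₁ b₂ (just k)))
      e' : parentIn s' q i ≡ just j
      e' = trans (parentIn-< k (node j a b) r q i i<k) (trans (parentIn-> j a b (just k) i j<i) (parentIn-root i b₁ b₂ (just j)))
      adj : SubtreeAdj G P (spine i) (spine j)
      adj with next j j<i (toℕ<n i)
      ... | j' , j'≡j+1 , j'≤i = spine j' , inRange⇒descendant (inLeft k r (inRight j a C)) i b₁ b₂ (spine j') (≤-reflexive (sym j'≡j+1) , ≤-<-trans j'≤i i<k) , spine-prev j' j j'≡j+1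
    ... | inj₂ (k' , e₁ , _ , k'<k) = inj₁ (parent-unchanged i ri (trans e' (trans (parentIn-nonRoot b (just j) (just k) i ¬root) (sym e))) , ¬pc)
      where
      e : parentIn s q i ≡ parentIn b (just k) i
      e = trans (parentIn-> j a (node k b r) q i j<i) (parentIn-< k b r (just j) i i<k)
      e' : parentIn s' q i ≡ parentIn b (just j) i
      e' = trans (parentIn-< k (node j a b) r q i i<k) (parentIn-> j a b (just k) i j<i)
      k≢k' : just k ≢ just k'
      k≢k' kk' = <-irrefl (cong toℕ (sym (just-injective kk'))) k'<k
      ¬root : ¬ RootedAt b i
      ¬root rt = k≢k' (trans (sym (parentIn-rootedAt b (just k) i rt)) e₁)
      ¬pc : P (spine i) ≡ just (spine k) → ¬ SubtreeAdj G P (spine i) (spine j)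
      ¬pc pc _ = k≢k' (trans (sym (parent-is-k i ri pc)) (trans e e₁))

    in-r : ∀ i → InRange (suc (toℕ k)) hi (toℕ i) → InRange lo hi (toℕ i) → RotationCase P P' (spine i) (spine k) (spine j)
    in-r i (k<i , i<hi) ri = inj₁ (parent-unchanged i ri (trans e' (sym e)) , ¬adj)
      where
      e : parentIn s q i ≡ parentIn r (just k) i
      e = trans (parentIn-> j a (node k b r) q i (<-trans j<k k<i)) (parentIn-> k b r (just j) i k<i)
      e' : parentIn s' q i ≡ parentIn r (just k) i
      e' = parentIn-> k (node j a b) r q i k<i
      ¬adj : P (spine i) ≡ just (spine k) → ¬ SubtreeAdj G P (spine i) (spine j)
      ¬adj pc with parentIn-outside⇒root r i k (k<i , i<hi) (λ z → <-irrefl refl (proj₁ z)) (trans (sym e) (parent-is-k i ri pc))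
      ... | r₁ , r₂ , refl =
        above-¬SubtreeAdj j (suc (toℕ k)) (s≤s j<k) (λ y d → proj₁ (descendant⇒inRange (inRight k b (inRight j a C)) i r₁ r₂ d))

    isRotation : RotationAt G P P' (spine j) (spine k)
    isRotation = rotation-in-context C j k a (node k b r) (node j a b) r (λ e → <-irrefl (cong toℕ (sym e)) j<k)
                   (toParent-rightChild C j k a b r) (toParent-leftChild C k j a b r) inside
      where
      inside : ∀ i → InRange lo hi (toℕ i) → i ≢ k → i ≢ j → RotationCase P P' (spine i) (spine k) (spine j)
      inside i ri i≢k i≢j with <-cmp (toℕ i) (toℕ j) | <-cmp (toℕ i) (toℕ k)
      ... | tri< i<j _ _ | _ = in-a i i<j ri
      ... | tri≈ _ e _ | _ = ⊥-elim (i≢j (toℕ-injective e))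
      ... | tri> _ _ j<i | tri< i<k _ _ = in-b i (j<i , i<k) ri
      ... | tri> _ _ _ | tri≈ _ e _ = ⊥-elim (i≢k (toℕ-injective e))
      ... | tri> _ _ _ | tri> _ _ k<i = in-r i (k<i , proj₂ ri) ri

  data LocalRotation : ∀ {lo hi} → SpineBST lo hi → SpineBST lo hi → Set where
    rotateRight : ∀ {lo hi} k j (a : SpineBST lo (toℕ j)) (b : SpineBST (suc (toℕ j)) (toℕ k)) (r : SpineBST (suc (toℕ k)) hi) →
                  LocalRotation (node k (node j a b) r) (node j a (node k b r))
    rotateLeft  : ∀ {lo hi} k j (a : SpineBST lo (toℕ j)) (b : SpineBST (suc (toℕ j)) (toℕ k)) (r : SpineBST (suc (toℕ k)) hi) →
                  LocalRotation (node j a (node k b r)) (node k (node j a b) r)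

  data RotationStep : SpineBST 0 n → SpineBST 0 n → Set where
    at : ∀ {lo hi q} (C : Context lo hi q) {s s'} → LocalRotation s s' → RotationStep (plug C s) (plug C s')

  RotationStep-sym : ∀ {t t'} → RotationStep t t' → RotationStep t' t
  RotationStep-sym (at C (rotateRight k j a b r)) = at C (rotateLeft k j a b r)
  RotationStep-sym (at C (rotateLeft k j a b r)) = at C (rotateRight k j a b r)

  RotationStep⇒Rotation : ∀ {t t'} → RotationStep t t' → Rotation G (toParent t) (toParent t')
  RotationStep⇒Rotation (at C (rotateRight k j a b r)) = spine k , spine j , RightRotation.isRotation C k j a b r
  RotationStep⇒Rotation (at C (rotateLeft k j a b r)) = spine j , spine k , LeftRotation.isRotation C j k a b r

  data Rotations : ℕ → SpineBST 0 n → SpineBST 0 n → Set where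
    []  : ∀ {t} → Rotations 0 t t
    _∷_ : ∀ {k t t' t''} → RotationStep t t' → Rotations k t' t'' → Rotations (suc k) t t''

  Rotations-snoc : ∀ {k t t' t''} → Rotations k t t' → RotationStep t' t'' → Rotations (suc k) t t''
  Rotations-snoc [] x = x ∷ []
  Rotations-snoc (y ∷ xs) x = y ∷ Rotations-snoc xs x

  Rotations-reverse : ∀ {k t t'} → Rotations k t t' → Rotations k t' t
  Rotations-reverse [] = []
  Rotations-reverse (x ∷ xs) = Rotations-snoc (Rotations-reverse xs) (RotationStep-sym x)

  Rotations-++ : ∀ {k₁ k₂ t t' t''} → Rotations k₁ t t' → Rotations k₂ t' t'' → Rotations (k₁ + k₂) t t''
  Rotations-++ [] ys = ys
  Rotations-++ (x ∷ xs) ys = x ∷ Rotations-++ xs ys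

  Rotations⇒Steps : 0 < n → ∀ {k t t'} {Q : Parent G} → Rotations k t t' → toParent t' ≗ Q → Steps G k (toParent t) Q
  Rotations⇒Steps _ [] e = done e
  Rotations⇒Steps pos (_∷_ {t' = t'} x xs) e = step (toParent-isSearchTree t' pos) (RotationStep⇒Rotation x) (Rotations⇒Steps pos xs e)

  size : ∀ {lo hi} → SpineBST lo hi → ℕ
  size (leaf _) = 0
  size (node k l r) = suc (size l + size r)

  size+lo≡hi : ∀ {lo hi} (s : SpineBST lo hi) → size s + lo ≡ hi
  size+lo≡hi (leaf e) = e
  size+lo≡hi {lo} {hi} (node k l r) = begin
    suc (size l + size r + lo) ≡⟨ cong suc (trans (+-assoc (size l) (size r) lo) (trans (cong (size l +_) (+-comm (size r) lo)) (sym (+-assoc (size l) lo (size r))))) ⟩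
    suc (size l + lo + size r) ≡⟨ cong (λ z → suc (z + size r)) (size+lo≡hi l) ⟩
    suc (toℕ k + size r)       ≡⟨ cong suc (+-comm (toℕ k) (size r)) ⟩
    suc (size r + toℕ k)       ≡⟨ +-suc (size r) (toℕ k) ⟨
    size r + suc (toℕ k)       ≡⟨ size+lo≡hi r ⟩
    hi                         ∎
    where open ≡-Reasoning

  offRightPath : ∀ {lo hi} → SpineBST lo hi → ℕ
  offRightPath (leaf _) = 0
  offRightPath (node k l r) = size l + offRightPath r

  offRightPath≤size : ∀ {lo hi} (s : SpineBST lo hi) → offRightPath s ≤ size s
  offRightPath≤size (leaf _) = z≤n
  offRightPath≤size (node k l r) = ≤-trans (+-monoʳ-≤ (size l) (offRightPath≤size r)) (n≤1+n _)

  offRightPath≤n : (t : SpineBST 0 n) → offRightPath t ≤ n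
  offRightPath≤n t = ≤-trans (offRightPath≤size t) (≤-reflexive (trans (sym (+-identityʳ (size t))) (size+lo≡hi t)))

  offRightPath-rotateRight : ∀ {lo hi} k j (a : SpineBST lo (toℕ j)) (b : SpineBST (suc (toℕ j)) (toℕ k)) (r : SpineBST (suc (toℕ k)) hi) →
    suc (offRightPath (node j a (node k b r))) ≡ offRightPath (node k (node j a b) r)
  offRightPath-rotateRight k j a b r = cong suc (sym (+-assoc (size a) (size b) (offRightPath r)))

  IsRightComb : ∀ {lo hi} → SpineBST lo hi → Set
  IsRightComb (leaf _) = ⊤
  IsRightComb (node k (leaf _) r) = IsRightComb r
  IsRightComb (node k (node _ _ _) r) = ⊥

  rightComb-unique : ∀ {lo hi} (s s' : SpineBST lo hi) → IsRightComb s → IsRightComb s' → s ≡ s'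
  rightComb-unique (leaf e) (leaf e') _ _ = cong leaf (≡-irrelevant e e')
  rightComb-unique (leaf refl) (node k' (leaf refl) r') _ _ = ⊥-elim (<-irrefl refl (bounds r'))
  rightComb-unique (node k (leaf refl) r) (leaf refl) _ _ = ⊥-elim (<-irrefl refl (bounds r))
  rightComb-unique (node k (leaf e) r) (node k' (leaf e') r') cr cr' with toℕ-injective (trans (sym e) e')
  ... | refl with ≡-irrelevant e e'
  ...   | refl = cong (node k (leaf e)) (rightComb-unique r r' cr cr')

  -- Right rotations at the rightmost path, each lowering offRightPath by one.
  rotate-to-rightComb : ∀ f {lo hi q} (C : Context lo hi q) (s : SpineBST lo hi) → offRightPath s ≡ f →
    Σ (SpineBST lo hi) λ comb → IsRightComb comb × Rotations f (plug C s) (plug C comb)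
  rotate-to-rightComb f C (leaf e) refl = leaf e , tt , []
  rotate-to-rightComb f C (node k (leaf e) r) eq with rotate-to-rightComb f (inRight k (leaf e) C) r eq
  ... | comb , isComb , rots = node k (leaf e) comb , isComb , rots
  rotate-to-rightComb zero C (node k (node j a b) r) ()
  rotate-to-rightComb (suc f) C (node k (node j a b) r) eq
    with rotate-to-rightComb f C (node j a (node k b r)) (suc-injective (trans (offRightPath-rotateRight k j a b r) eq))
  ... | comb , isComb , rots = comb , isComb , at C (rotateRight k j a b r) ∷ rots

  to-rightComb : (t : SpineBST 0 n) → Σ (SpineBST 0 n) λ comb → IsRightComb comb × Rotations (offRightPath t) t comb
  to-rightComb t = rotate-to-rightComb _ top t refl

  module FromSearchTree (par : Parent G) (ST : IsSearchTree G par) (NF : NoFreeLeg n m par) where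
    root : V
    root = proj₁ ST

    rooted : IsRootedTree G par root
    rooted = proj₁ (proj₂ ST)

    root-Anc : ∀ v → Anc G par root v
    root-Anc = proj₂ rooted

    component : ∀ v c → par c ≡ just v → IsComponent G (λ x → Anc G par v x × (x ≢ v)) (Anc G par c)
    component = proj₂ (proj₂ ST)

    leg-leaf : ∀ {i j y} → Anc G par (leg i j) y → y ≡ leg i j
    leg-leaf {i} {j} {y} d with y ≟V leg i j
    ... | yes e = e
    ... | no ne = ⊥-elim (NF i j _ (proj₁ (proj₂ (child-towards _≟V_ d ne))))

    record Covers (lo hi : ℕ) (q : Maybe (Fin n)) (v : V) : Set where
      constructor covers
      field
        parent : par v ≡ mapSpine q
        inside : ∀ y → Anc G par v y → InRange lo hi (index y)
        cover  : ∀ y → InRange lo hi (index y) → Anc G par v y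
    open Covers

    Realised : ℕ → ℕ → Maybe (Fin n) → Set
    Realised lo hi q = Σ (SpineBST lo hi) λ t → ∀ i → InRange lo hi (toℕ i) → par (spine i) ≡ mapSpine (parentIn t q i)

    covering-spine : ∀ {lo hi q v} → Covers lo hi q v → Σ (Fin n) λ k → v ≡ spine k
    covering-spine {v = spine k} _ = k , refl
    covering-spine {v = leg i j} cov with leg-leaf (cover cov (spine i) (inside cov (leg i j) here))
    ... | ()

    root-inRange : ∀ {lo hi q v} → Covers lo hi q v → InRange lo hi (index v)
    root-inRange {v = v} cov = inside cov v here

    module ChildOf {lo hi q} (k : Fin n) (cov : Covers lo hi q (spine k)) {c : V} (pc : par c ≡ just (spine k)) where
      S U : V → Set
      S = Anc G par c
      U x = Anc G par (spine k) x × (x ≢ spine k)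

      S-component : IsComponent G U S
      S-component = component (spine k) c pc

      S⊆U : ∀ x → S x → U x
      S⊆U = proj₁ S-component

      S-closed : ∀ {x y} → S x → U y → CatAdj x y → S y
      S-closed {x} {y} sx uy adj with Anc? _≟V_ rooted c y
      ... | yes sy = sy
      ... | no ¬sy = ⊥-elim (proj₂ (proj₂ (proj₂ S-component)) x y sx uy ¬sy adj)

      S-path : ∀ {x y} → S x → S y → PathIn G S x y
      S-path {x} {y} = proj₁ (proj₂ (proj₂ S-component)) x y

      S-range : ∀ y → S y → InRange lo hi (index y)
      S-range y sy = inside cov y (proj₁ (S⊆U y sy))

      k-range : InRange lo hi (toℕ k)
      k-range = root-inRange cov

      covers-left : ∀ i₀ → toℕ i₀ ≡ lo → toℕ i₀ < toℕ k → S (spine i₀) → Covers lo (toℕ k) (just k) c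
      covers-left i₀ e₀ i₀<k s₀ = covers pc inside′ (interval-closed S i₀ e₀ s₀ (λ sx ry adj → S-closed sx (in-U ry) adj))
        where
        inside′ : ∀ y → S y → InRange lo (toℕ k) (index y)
        inside′ y sy = proj₁ (S-range y sy) , path-stays-below k (λ z sz → proj₂ (S⊆U z sz)) (S-path s₀ sy) i₀<k
        in-U : ∀ {y} → InRange lo (toℕ k) (index y) → U y
        in-U {y} (a , b) = cover cov y (a , <-trans b (proj₂ k-range)) , λ { refl → <-irrefl refl b }

      covers-right : ∀ i₁ → toℕ i₁ ≡ suc (toℕ k) → S (spine i₁) → Covers (suc (toℕ k)) hi (just k) c
      covers-right i₁ e₁ s₁ = covers pc inside′ (interval-closed S i₁ e₁ s₁ (λ sx ry adj → S-closed sx (in-U ry) adj))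
        where
        inside′ : ∀ y → S y → InRange (suc (toℕ k)) hi (index y)
        inside′ y sy = path-stays-above k (λ z sz → proj₂ (S⊆U z sz)) (S-path s₁ sy) (≤-reflexive (sym e₁)) , proj₂ (S-range y sy)
        in-U : ∀ {y} → InRange (suc (toℕ k)) hi (index y) → U y
        in-U {y} (a , b) = cover cov y (≤-trans (proj₁ k-range) (≤-trans (n≤1+n _) a) , b) , λ { refl → <-irrefl refl a }

    child-towards-index : ∀ {lo hi q} k → Covers lo hi q (spine k) → ∀ {x} (x<n : x < n) → InRange lo hi x → x ≢ toℕ k →
      Σ V λ c → (par c ≡ just (spine k)) × Anc G par c (spine (fromℕ< x<n))
    child-towards-index k cov x<n rx x≢k =
      child-towards _≟V_ (cover cov (spine (fromℕ< x<n)) (subst (InRange _ _) (sym (toℕ-fromℕ< x<n)) rx))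
        (λ e → x≢k (trans (sym (toℕ-fromℕ< x<n)) (cong index e)))

    left-child : ∀ {lo hi q} k → Covers lo hi q (spine k) → lo < toℕ k → Σ V (Covers lo (toℕ k) (just k))
    left-child {lo} k cov lo<k with child-towards-index k cov lo<n (≤-refl , <-trans lo<k (proj₂ (root-inRange cov))) (<⇒≢ lo<k)
      where
      lo<n : lo < n
      lo<n = <-trans lo<k (toℕ<n k)
    ... | c , pc , dc = c , ChildOf.covers-left k cov pc _ (toℕ-fromℕ< _) (subst (_< toℕ k) (sym (toℕ-fromℕ< _)) lo<k) dc

    right-child : ∀ {lo hi q} k → Covers lo hi q (spine k) → suc (toℕ k) < hi → hi ≤ n → Σ V (Covers (suc (toℕ k)) hi (just k))
    right-child k cov k+1<hi hi≤n
      with child-towards-index k cov (<-≤-trans k+1<hi hi≤n) (≤-trans (proj₁ (root-inRange cov)) (n≤1+n _) , k+1<hi) (λ e → <-irrefl (sym e) (n<1+n _))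
    ... | c , pc , dc = c , ChildOf.covers-right k cov pc _ (toℕ-fromℕ< _) dc

    empty : ∀ {lo hi q} → lo ≡ hi → Realised lo hi q
    empty e = leaf e , λ i r → ⊥-elim (<-irrefl refl (<-≤-trans (proj₂ r) (subst (_≤ toℕ i) e (proj₁ r))))

    build : ∀ fuel {lo hi q v} → hi ≤ fuel + lo → hi ≤ n → Covers lo hi q v → Realised lo hi q
    build fuel hf hi≤n cov with covering-spine cov
    build zero {lo} {hi} hf hi≤n cov | k , refl = ⊥-elim (<-irrefl refl (<-≤-trans k<hi (≤-trans hf lo≤k)))
      where
      lo≤k : lo ≤ toℕ k
      lo≤k = proj₁ (root-inRange cov)
      k<hi : toℕ k < hi
      k<hi = proj₂ (root-inRange cov)
    build (suc f) {lo} {hi} {q} hf hi≤n cov | k , refl = node k (proj₁ left) (proj₁ right) , parents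
      where
      lo≤k : lo ≤ toℕ k
      lo≤k = proj₁ (root-inRange cov)
      k<hi : toℕ k < hi
      k<hi = proj₂ (root-inRange cov)
      left : Realised lo (toℕ k) (just k)
      left with lo ≟ toℕ k
      ... | yes e = empty e
      ... | no ne = build f (≤-pred (≤-trans k<hi hf)) (<⇒≤ (toℕ<n k)) (proj₂ (left-child k cov (≤∧≢⇒< lo≤k ne)))
      right : Realised (suc (toℕ k)) hi (just k)
      right with suc (toℕ k) ≟ hi
      ... | yes e = empty e
      ... | no ne = build f hf′ hi≤n (proj₂ (right-child k cov (≤∧≢⇒< k<hi ne) hi≤n))
        where
        hf′ : hi ≤ f + suc (toℕ k)
        hf′ = ≤-trans hf (≤-trans (s≤s (+-monoʳ-≤ f lo≤k)) (≤-reflexive (sym (+-suc f (toℕ k)))))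
      parents : ∀ i → InRange lo hi (toℕ i) → par (spine i) ≡ mapSpine (parentIn (node k (proj₁ left) (proj₁ right)) q i)
      parents i (a , b) with <-cmp (toℕ i) (toℕ k)
      ... | tri< lt _ _ = proj₂ left i (a , lt)
      ... | tri> _ _ gt = proj₂ right i (gt , b)
      ... | tri≈ _ e _ with toℕ-injective e
      ...   | refl = parent cov

    leg-parent : ∀ i j → par (leg i j) ≡ just (spine i)
    leg-parent i j with par (leg i j) in eq
    ... | nothing with leg-leaf (subst (λ z → Anc G par z (spine i)) (Anc-to-root (root-Anc (leg i j)) eq) (root-Anc (spine i)))
    ...   | ()
    leg-parent i j | just (leg i' j') = ⊥-elim (NF i' j' (leg i j) eq)
    leg-parent i j | just (spine k) with k Fin.≟ i
    ... | yes refl = refl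
    -- Otherwise the component {leg i j} below spine k would be adjacent to spine i,
    -- which also lies below spine k: every path from spine k to leg i j passes through it.
    ... | no k≢i = ⊥-elim (proj₂ (proj₂ (proj₂ (component (spine k) (leg i j) eq))) (leg i j) (spine i) here
                    (spine-i-below-k , λ e → k≢i (sym (just-spine-injective (cong just e))))
                    (λ d → spine≢leg (leg-leaf d)) (leg-spine i j))
      where
      spine≢leg : spine i ≢ leg i j
      spine≢leg ()
      spine-i-below-k : Anc G par (spine k) (spine i)
      spine-i-below-k with par (spine k) in eq′
      ... | nothing = subst (λ z → Anc G par z (spine i)) (Anc-to-root (root-Anc (spine k)) eq′) (root-Anc (spine i))
      ... | just w = path-to-leg-via-spine (proj₁ (proj₂ (proj₂ (component w (spine k) eq′))) (spine k) (leg i j) here (there eq here)) (λ ())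

    toParent-complete : Σ (SpineBST 0 n) λ t → par ≗ toParent t
    toParent-complete = proj₁ whole , parents
      where
      whole : Realised 0 n nothing
      whole = build n (≤-reflexive (sym (+-identityʳ n))) ≤-refl
                (covers (proj₁ rooted) (λ y _ → z≤n , index<n y) (λ y _ → root-Anc y))
      parents : par ≗ toParent (proj₁ whole)
      parents (spine i) = proj₂ whole i (z≤n , toℕ<n i)
      parents (leg i j) = leg-parent i j

  rotations-via-rightComb : (t₁ t₂ : SpineBST 0 n) → Rotations (offRightPath t₁ + offRightPath t₂) t₁ t₂
  rotations-via-rightComb t₁ t₂ with to-rightComb t₁ | to-rightComb t₂
  ... | c₁ , comb₁ , rots₁ | c₂ , comb₂ , rots₂ with rightComb-unique c₁ c₂ comb₁ comb₂
  ...   | refl = Rotations-++ rots₁ (Rotations-reverse rots₂)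

  offRightPath-sum≤2n : (t₁ t₂ : SpineBST 0 n) → offRightPath t₁ + offRightPath t₂ ≤ 2 * n
  offRightPath-sum≤2n t₁ t₂ = ≤-trans (+-mono-≤ (offRightPath≤n t₁) (offRightPath≤n t₂)) (≤-reflexive (cong (n +_) (sym (+-identityʳ n))))

  rotation-distance≤2n : 0 < n → (T₁ T₂ : Parent G) → IsSearchTree G T₁ → IsSearchTree G T₂ →
    NoFreeLeg n m T₁ → NoFreeLeg n m T₂ → Σ ℕ λ k → (k ≤ 2 * n) × Steps G k T₁ T₂
  rotation-distance≤2n 0<n T₁ T₂ st₁ st₂ nf₁ nf₂
    with FromSearchTree.toParent-complete T₁ st₁ nf₁ | FromSearchTree.toParent-complete T₂ st₂ nf₂
  ... | t₁ , T₁≗t₁ | t₂ , T₂≗t₂ =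
    offRightPath t₁ + offRightPath t₂ , offRightPath-sum≤2n t₁ t₂ ,
    Steps-respˡ T₁≗t₁ (Rotations⇒Steps 0<n (rotations-via-rightComb t₁ t₂) (λ x → sym (T₂≗t₂ x)))

lemma6 : Σ ℕ λ c → (0 < c) ×
    ((n : ℕ) → 0 < n → (m : Fin n → ℕ) →
    (T₁ T₂ : Parent (Caterpillar n m)) →
    IsSearchTree (Caterpillar n m) T₁ → IsSearchTree (Caterpillar n m) T₂ →
    NoFreeLeg n m T₁ → NoFreeLeg n m T₂ →
    Σ ℕ λ k → (k ≤ c * n) × Steps (Caterpillar n m) k T₁ T₂)
lemma6 = 2 , s≤s z≤n , λ n 0<n m → CaterpillarRotations.rotation-distance≤2n n m 0<n
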